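{- (Soundness) For any set $\Phi\cup\{\varphi\}\subseteq Fm$: if $\Phi\vdash_L\varphi$ then $\Phi\Vdash\varphi$.
   Context: Let $V=\{x_0,x_1,\dots\}$ be an infinite set of propositional variables; $Fm$ is generated from $V$ by $\bot$, binary $\rightarrow,\vee,\wedge$ and unary $\square$. Abbreviations: $\neg\varphi:=\varphi\rightarrow\bot$, $\varphi\equiv\psi:=\square(\varphi\rightarrow\psi)\wedge\square(\psi\rightarrow\varphi)$; $\chi[x:=\varphi]$ is substitution of $\varphi$ for $x$ in $\chi$. The logic L: axioms are all formulas of the forms (i) substitution instances (variables replaced by arbitrary formulas of $Fm$) of intuitionistic propositional tautologies; (ii) $\square\varphi\rightarrow\varphi$; (iii) $\square(\varphi\rightarrow\psi)\rightarrow(\square(\psi\rightarrow\chi)\rightarrow\square(\varphi\rightarrow\chi))$; (iv) $\square(\varphi\vee\psi)\rightarrow(\square\varphi\vee\square\psi)$; rules are Modus Ponens and Axiom Necessitation (from an axiom $\varphi$ of form (i)–(iv) infer $\square\varphi$); additionally all formulas $\varphi\vee\neg\varphi$ and $(\varphi\equiv\psi)\rightarrow(\chi[x:=\varphi]\equiv\chi[x:=\psi])$ are theorems (usable in derivations, not subject to Axiom Necessitation). $\Phi\vdash_L\varphi$: $\varphi$ is derivable from $\Phi$ in L. Semantics: a Heyting algebra $(M,f_\top,f_\bot,f_\vee,f_\wedge,f_\rightarrow)$ is a bounded lattice (top $f_\top$, bottom $f_\bot$, order $\le$) with $f_\rightarrow(m,m')$ the greatest $m''$ with $f_\wedge(m,m'')\le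 m'$; a filter is a non-empty upward closed $F\subseteq M$ closed under $f_\wedge$ with $f_\bot\notin F$; an ultrafilter is a maximal filter. A model $\mathcal{M}=(M,\mathit{TRUE},f_\top,f_\bot,f_\rightarrow,f_\vee,f_\wedge,f_\square)$ is a Heyting algebra with an ultrafilter $\mathit{TRUE}$ and unary $f_\square$ such that for all $m,m',m''$: (1) $f_\square(m)\le m$; (2) $f_\square(f_\rightarrow(m,m'))\le f_\rightarrow(f_\square(f_\rightarrow(m',m'')),f_\square(f_\rightarrow(m,m'')))$; (3) $f_\square(f_\vee(m,m'))\le f_\vee(f_\square(m),f_\square(m'))$; (4) $f_\square(m)\in\mathit{TRUE}\iff m=f_\top$. An assignment $\gamma:V\to M$ extends homomorphically to $Fm$ ($\gamma(\bot)=f_\bot$, $\gamma(\square\varphi)=f_\square(\gamma(\varphi))$, $\gamma(\varphi*\psi)=f_*(\gamma(\varphi),\gamma(\psi))$). $(\mathcal{M},\gamma)\vDash\varphi$ iff $\gamma(\varphi)\in\mathit{TRUE}$; $\Phi\Vdash\varphi$ iff every interpretation $(\mathcal{M},\gamma)$ satisfying all of $\Phi$ satisfies $\varphi$. -}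

module Defs where

open import Level using (Level; _⊔_) renaming (suc to lsuc; zero to lzero)
open import Data.Nat using (ℕ; _≟_)
open import Data.Product using (_×_; ∃; _,_)
open import Relation.Nullary using (¬_; yes; no)
open import Relation.Unary using (Pred; _⊆_; _∈_)
open import Relation.Binary.PropositionalEquality using (_≡_)
open import Relation.Binary.Lattice.Bundles using (HeytingAlgebra)

infixr 5 _⇒_
infixr 6 _∨′_
infixr 7 _∧′_

data Fm : Set where
  var  : ℕ → Fm
  ⊥′   : Fm
  _⇒_  : Fm → Fm → Fm
  _∨′_ : Fm → Fm → Fm
  _∧′_ : Fm → Fm → Fm
  □_   : Fm → Fm

¬′_ : Fm → Fm
¬′ φ = φ ⇒ ⊥′

_≡′_ : Fm → Fm → Fm
φ ≡′ ψ = (□ (φ ⇒ ψ)) ∧′ (□ (ψ ⇒ φ))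

_[_≔_] : Fm → ℕ → Fm → Fm
var y    [ x ≔ φ ] with y ≟ x
... | yes _ = φ
... | no  _ = var y
⊥′       [ x ≔ φ ] = ⊥′
(χ ⇒ χ′) [ x ≔ φ ] = (χ [ x ≔ φ ]) ⇒ (χ′ [ x ≔ φ ])
(χ ∨′ χ′) [ x ≔ φ ] = (χ [ x ≔ φ ]) ∨′ (χ′ [ x ≔ φ ])
(χ ∧′ χ′) [ x ≔ φ ] = (χ [ x ≔ φ ]) ∧′ (χ′ [ x ≔ φ ])
(□ χ)    [ x ≔ φ ] = □ (χ [ x ≔ φ ])

data PFm : Set where
  pvar : ℕ → PFm
  p⊥   : PFm
  _p⇒_ : PFm → PFm → PFm
  _p∨_ : PFm → PFm → PFm
  _p∧_ : PFm → PFm → PFm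

infixr 5 _p⇒_

data IPC : PFm → Set where
  ax-K   : ∀ A B → IPC (A p⇒ (B p⇒ A))
  ax-S   : ∀ A B C → IPC ((A p⇒ (B p⇒ C)) p⇒ ((A p⇒ B) p⇒ (A p⇒ C)))
  ax-∧E₁ : ∀ A B → IPC ((A p∧ B) p⇒ A)
  ax-∧E₂ : ∀ A B → IPC ((A p∧ B) p⇒ B)
  ax-∧I  : ∀ A B → IPC (A p⇒ (B p⇒ (A p∧ B)))
  ax-∨I₁ : ∀ A B → IPC (A p⇒ (A p∨ B))
  ax-∨I₂ : ∀ A B → IPC (B p⇒ (A p∨ B))
  ax-∨E  : ∀ A B C → IPC ((A p⇒ C) p⇒ ((B p⇒ C) p⇒ ((A p∨ B) p⇒ C)))
  ax-⊥E  : ∀ A → IPC (p⊥ p⇒ A)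
  mp     : ∀ {A B} → IPC (A p⇒ B) → IPC A → IPC B

inst : (ℕ → Fm) → PFm → Fm
inst σ (pvar n) = σ n
inst σ p⊥       = ⊥′
inst σ (A p⇒ B) = inst σ A ⇒ inst σ B
inst σ (A p∨ B) = inst σ A ∨′ inst σ B
inst σ (A p∧ B) = inst σ A ∧′ inst σ B

data Axiom : Fm → Set where
  ax-int  : ∀ {A} → IPC A → (σ : ℕ → Fm) → Axiom (inst σ A)
  ax-T    : ∀ φ → Axiom ((□ φ) ⇒ φ)
  ax-tr   : ∀ φ ψ χ →
            Axiom ((□ (φ ⇒ ψ)) ⇒ ((□ (ψ ⇒ χ)) ⇒ (□ (φ ⇒ χ))))
  ax-dis  : ∀ φ ψ → Axiom ((□ (φ ∨′ ψ)) ⇒ ((□ φ) ∨′ (□ ψ)))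

data _⊢L_ {p : Level} (Φ : Pred Fm p) : Fm → Set p where
  hyp   : ∀ {φ} → φ ∈ Φ → Φ ⊢L φ
  axiom : ∀ {φ} → Axiom φ → Φ ⊢L φ
  tnd   : ∀ φ → Φ ⊢L (φ ∨′ (¬′ φ))
  congr : ∀ φ ψ χ x → Φ ⊢L ((φ ≡′ ψ) ⇒ ((χ [ x ≔ φ ]) ≡′ (χ [ x ≔ ψ ])))
  MP    : ∀ {φ ψ} → Φ ⊢L (φ ⇒ ψ) → Φ ⊢L φ → Φ ⊢L ψ
  AN    : ∀ {φ} → Axiom φ → Φ ⊢L (□ φ)

module _ {c ℓ₁ ℓ₂ : Level} (H : HeytingAlgebra c ℓ₁ ℓ₂) where
  open HeytingAlgebra H

  record IsFilter {t : Level} (F : Pred Carrier t) : Set (c ⊔ ℓ₂ ⊔ t) where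
    field
      nonempty  : ∃ λ m → m ∈ F
      up-closed : ∀ {m m′} → m ∈ F → m ≤ m′ → m′ ∈ F
      ∧-closed  : ∀ {m m′} → m ∈ F → m′ ∈ F → (m ∧ m′) ∈ F
      proper    : ¬ (⊥ ∈ F)

  -- maximal filter: every filter G extending F (G ranging over predicates
  -- of level c ⊔ ℓ₁ ⊔ ℓ₂ ⊔ t, large enough for filters generated from F) is
  -- contained in F
  record IsUltrafilter {t : Level} (F : Pred Carrier t) : Set (lsuc (c ⊔ ℓ₁ ⊔ ℓ₂ ⊔ t)) where
    field
      isFilter : IsFilter F
      maximal  : ∀ (G : Pred Carrier (c ⊔ ℓ₁ ⊔ ℓ₂ ⊔ t)) → IsFilter G → F ⊆ G → G ⊆ F

record Model (c ℓ₁ ℓ₂ t : Level) : Set (lsuc (c ⊔ ℓ₁ ⊔ ℓ₂ ⊔ t)) where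
  field
    heyting : HeytingAlgebra c ℓ₁ ℓ₂
  open HeytingAlgebra heyting public
  field
    TRUE          : Pred Carrier t
    TRUE-ultra    : IsUltrafilter heyting TRUE
    f□            : Carrier → Carrier
    f□-cong       : ∀ {m m′} → m ≈ m′ → f□ m ≈ f□ m′
    cond1         : ∀ m → f□ m ≤ m
    cond2         : ∀ m m′ m″ → f□ (m ⇨ m′) ≤ (f□ (m′ ⇨ m″) ⇨ f□ (m ⇨ m″))
    cond3         : ∀ m m′ → f□ (m ∨ m′) ≤ (f□ m ∨ f□ m′)
    cond4         : ∀ m → (f□ m ∈ TRUE → m ≈ ⊤) × (m ≈ ⊤ → f□ m ∈ TRUE)

⟦_⟧ : ∀ {c ℓ₁ ℓ₂ t} {𝓜 : Model c ℓ₁ ℓ₂ t} → Fm → (ℕ → Model.Carrier 𝓜) → Model.Carrier 𝓜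
⟦_⟧ {𝓜 = 𝓜} (var n)  γ = γ n
⟦_⟧ {𝓜 = 𝓜} ⊥′       γ = Model.⊥ 𝓜
⟦_⟧ {𝓜 = 𝓜} (φ ⇒ ψ)  γ = Model._⇨_ 𝓜 (⟦_⟧ {𝓜 = 𝓜} φ γ) (⟦_⟧ {𝓜 = 𝓜} ψ γ)
⟦_⟧ {𝓜 = 𝓜} (φ ∨′ ψ) γ = Model._∨_ 𝓜 (⟦_⟧ {𝓜 = 𝓜} φ γ) (⟦_⟧ {𝓜 = 𝓜} ψ γ)
⟦_⟧ {𝓜 = 𝓜} (φ ∧′ ψ) γ = Model._∧_ 𝓜 (⟦_⟧ {𝓜 = 𝓜} φ γ) (⟦_⟧ {𝓜 = 𝓜} ψ γ)
⟦_⟧ {𝓜 = 𝓜} (□ φ)    γ = Model.f□ 𝓜 (⟦_⟧ {𝓜 = 𝓜} φ γ)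

_,_⊨_ : ∀ {c ℓ₁ ℓ₂ t} (𝓜 : Model c ℓ₁ ℓ₂ t) → (ℕ → Model.Carrier 𝓜) → Fm → Set t
𝓜 , γ ⊨ φ = ⟦_⟧ {𝓜 = 𝓜} φ γ ∈ Model.TRUE 𝓜

_⊩[_,_,_,_]_ : ∀ {p} → Pred Fm p → (c ℓ₁ ℓ₂ t : Level) → Fm → Set (p ⊔ lsuc (c ⊔ ℓ₁ ⊔ ℓ₂ ⊔ t))
Φ ⊩[ c , ℓ₁ , ℓ₂ , t ] φ =
  (𝓜 : Model c ℓ₁ ℓ₂ t) (γ : ℕ → Model.Carrier 𝓜) →
  (∀ ψ → ψ ∈ Φ → 𝓜 , γ ⊨ ψ) → 𝓜 , γ ⊨ φ

module Submission where

open import Defs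
open import Level using (Level; Lift; lift; _⊔_)
open import Data.Empty using () renaming (⊥ to Empty)
open import Data.Nat using (ℕ; _≟_)
open import Data.Product using (∃; _×_; _,_; proj₁; proj₂)
open import Function using (_∘_)
open import Relation.Nullary using (¬_; yes; no)
open import Relation.Unary using (Pred; _∈_)
open import Relation.Binary.PropositionalEquality as ≡ using (_≡_)
open import Relation.Binary.Lattice.Bundles using (HeytingAlgebra)
import Relation.Binary.Lattice.Properties.HeytingAlgebra as HeytingProperties
import Relation.Binary.Lattice.Properties.MeetSemilattice as MeetProperties
import Relation.Binary.Lattice.Properties.JoinSemilattice as JoinProperties

-- Axioms (i)–(iv) evaluate to ⊤ in every model, so MP and Axiom Necessitation
-- (via condition (4)) preserve membership in TRUE.  The two remaining theorem
-- schemes are where TRUE being an ultrafilter matters: an ultrafilter contains b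
-- as soon as it omits ¬ b, so it contains every a ∨ ¬ a and is closed under
-- implication introduction; and (4) turns φ ≡′ ψ ∈ TRUE into ⟦ φ ⟧ ≈ ⟦ ψ ⟧,
-- which substitution preserves.

module HeytingValidity {c ℓ₁ ℓ₂ : Level} (H : HeytingAlgebra c ℓ₁ ℓ₂) where
  open HeytingAlgebra H
  open HeytingProperties H using (⇨-eval; ∧-distribˡ-∨-≤)

  ⟦_⟧ₚ : PFm → (ℕ → Carrier) → Carrier
  ⟦ pvar n ⟧ₚ ρ = ρ n
  ⟦ p⊥     ⟧ₚ ρ = ⊥
  ⟦ A p⇒ B ⟧ₚ ρ = ⟦ A ⟧ₚ ρ ⇨ ⟦ B ⟧ₚ ρ
  ⟦ A p∨ B ⟧ₚ ρ = ⟦ A ⟧ₚ ρ ∨ ⟦ B ⟧ₚ ρ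
  ⟦ A p∧ B ⟧ₚ ρ = ⟦ A ⟧ₚ ρ ∧ ⟦ B ⟧ₚ ρ

  π₁ : ∀ {x y} → x ∧ y ≤ x
  π₁ = x∧y≤x _ _

  π₂ : ∀ {x y} → x ∧ y ≤ y
  π₂ = x∧y≤y _ _

  ⇨-intro : ∀ {w x y} → w ∧ x ≤ y → w ≤ x ⇨ y
  ⇨-intro = transpose-⇨

  ⇨-elim : ∀ {w x y} → w ≤ x ⇨ y → w ≤ x → w ≤ y
  ⇨-elim p q = trans (∧-greatest p q) ⇨-eval

  ∨-elim : ∀ {w x y z} → w ≤ x ∨ y → w ∧ x ≤ z → w ∧ y ≤ z → w ≤ z
  ∨-elim p q r = trans (∧-greatest refl p) (trans (∧-distribˡ-∨-≤ _ _ _) (∨-least q r))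

  ≤⇒⇨≈⊤ : ∀ {x y} → x ≤ y → x ⇨ y ≈ ⊤
  ≤⇒⇨≈⊤ p = antisym (maximum _) (⇨-intro (trans π₂ p))

  ⇨≈⊤⇒≤ : ∀ {x y} → x ⇨ y ≈ ⊤ → x ≤ y
  ⇨≈⊤⇒≤ e = ⇨-elim (trans (maximum _) (reflexive (Eq.sym e))) refl

  IPC-valid : ∀ {A} → IPC A → ∀ ρ → ⊤ ≤ ⟦ A ⟧ₚ ρ
  IPC-valid (ax-K A B)   ρ = ⇨-intro (⇨-intro (trans π₁ π₂))
  IPC-valid (ax-S A B C) ρ = ⇨-intro (⇨-intro (⇨-intro
    (⇨-elim (⇨-elim (trans π₁ (trans π₁ π₂)) π₂) (⇨-elim (trans π₁ π₂) π₂))))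
  IPC-valid (ax-∧E₁ A B) ρ = ⇨-intro (trans π₂ π₁)
  IPC-valid (ax-∧E₂ A B) ρ = ⇨-intro (trans π₂ π₂)
  IPC-valid (ax-∧I A B)  ρ = ⇨-intro (⇨-intro (∧-greatest (trans π₁ π₂) π₂))
  IPC-valid (ax-∨I₁ A B) ρ = ⇨-intro (trans π₂ (x≤x∨y _ _))
  IPC-valid (ax-∨I₂ A B) ρ = ⇨-intro (trans π₂ (y≤x∨y _ _))
  IPC-valid (ax-∨E A B C) ρ = ⇨-intro (⇨-intro (⇨-intro (∨-elim π₂
    (⇨-elim (trans π₁ (trans π₁ (trans π₁ π₂))) π₂)
    (⇨-elim (trans π₁ (trans π₁ π₂)) π₂))))
  IPC-valid (ax-⊥E A)    ρ = ⇨-intro (trans π₂ (minimum _))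
  IPC-valid (mp d e)     ρ = ⇨-elim (IPC-valid d ρ) (IPC-valid e ρ)

module UltrafilterProperties {c ℓ₁ ℓ₂ t : Level} (H : HeytingAlgebra c ℓ₁ ℓ₂)
       {F : Pred (HeytingAlgebra.Carrier H) t} (F-ultra : IsUltrafilter H F) where
  open HeytingAlgebra H
  open HeytingProperties H
    using (⇨-eval; ⇨-unit; y≤x⇨y; ⇨ʳ-covariant; ⇨ˡ-contravariant; ⇨-applyʳ;
           ⇨-distribˡ-∧-≥; de-morgan₁)
  open MeetProperties meetSemilattice using (∧-monotonic)
  open IsUltrafilter F-ultra
  open IsFilter isFilter

  ⊤≤⇒∈ : ∀ {x} → ⊤ ≤ x → x ∈ F
  ⊤≤⇒∈ p = up-closed (proj₂ nonempty) (trans (maximum _) p)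

  ∈-⇨-elim : ∀ {a b} → (a ⇨ b) ∈ F → a ∈ F → b ∈ F
  ∈-⇨-elim h h′ = up-closed (∧-closed h h′) ⇨-eval

  ∈-consistent : ∀ {a} → a ∈ F → (a ⇨ ⊥) ∈ F → Empty
  ∈-consistent h h′ = proper (∈-⇨-elim h′ h)

  -- { m | f ≤ b ⇨ m for some f ∈ F } is the filter generated by F and b.
  ⇨⊥∉⇒∈ : ∀ {b} → ¬ ((b ⇨ ⊥) ∈ F) → b ∈ F
  ⇨⊥∉⇒∈ {b} ¬b∉F = maximal G G-isFilter (λ h → lift (_ , h , y≤x⇨y))
                             (lift (_ , proj₂ nonempty , trans (maximum _) (reflexive (Eq.sym ⇨-unit))))
    where
    G : Pred Carrier (c ⊔ ℓ₁ ⊔ ℓ₂ ⊔ t)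
    G m = Lift (c ⊔ ℓ₁ ⊔ ℓ₂ ⊔ t) (∃ λ f → (f ∈ F) × (f ≤ b ⇨ m))

    G-isFilter : IsFilter H G
    G-isFilter = record
      { nonempty  = ⊤ , lift (_ , proj₂ nonempty , trans (maximum _) y≤x⇨y)
      ; up-closed = λ { (lift (f , f∈F , p)) q → lift (f , f∈F , trans p (⇨ʳ-covariant q)) }
      ; ∧-closed  = λ { (lift (f , f∈F , p)) (lift (f′ , f′∈F , p′)) →
          lift (f ∧ f′ , ∧-closed f∈F f′∈F , trans (∧-monotonic p p′) (⇨-distribˡ-∧-≥ _ _ _)) }
      ; proper    = λ { (lift (f , f∈F , p)) → ¬b∉F (up-closed f∈F p) }
      }

  ∈-¬¬-elim : ∀ {b} → ((b ⇨ ⊥) ⇨ ⊥) ∈ F → b ∈ F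
  ∈-¬¬-elim h = ⇨⊥∉⇒∈ (λ h′ → ∈-consistent h′ h)

  ∈-excluded-middle : ∀ a → (a ∨ (a ⇨ ⊥)) ∈ F
  ∈-excluded-middle a = ⇨⊥∉⇒∈ (λ h → proper (up-closed h ¬[a∨¬a]≤⊥))
    where
    ¬[a∨¬a]≤⊥ : (a ∨ (a ⇨ ⊥)) ⇨ ⊥ ≤ ⊥
    ¬[a∨¬a]≤⊥ = trans (reflexive (de-morgan₁ _ _)) (⇨-applyʳ refl)

  ∈-⇨-intro : ∀ {a b} → (a ∈ F → b ∈ F) → (a ⇨ b) ∈ F
  ∈-⇨-intro {a} {b} f = ⇨⊥∉⇒∈ λ h →
    ∈-consistent (f (∈-¬¬-elim (up-closed h ¬[a⇨b]≤¬¬a))) (up-closed h ¬[a⇨b]≤¬b)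
    where
    ¬[a⇨b]≤¬¬a : (a ⇨ b) ⇨ ⊥ ≤ (a ⇨ ⊥) ⇨ ⊥
    ¬[a⇨b]≤¬¬a = ⇨ˡ-contravariant (⇨ʳ-covariant (minimum b))

    ¬[a⇨b]≤¬b : (a ⇨ b) ⇨ ⊥ ≤ b ⇨ ⊥
    ¬[a⇨b]≤¬b = ⇨ˡ-contravariant y≤x⇨y

module ModelProperties {c ℓ₁ ℓ₂ t : Level} (𝓜 : Model c ℓ₁ ℓ₂ t) where
  open Model 𝓜
  open HeytingProperties heyting using (⇨-cong)
  open MeetProperties meetSemilattice using (∧-cong)
  open JoinProperties joinSemilattice using (∨-cong)
  open HeytingValidity heyting
  open UltrafilterProperties heyting TRUE-ultra
  open IsFilter (IsUltrafilter.isFilter TRUE-ultra) using (up-closed; ∧-closed)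

  ⟦_⟧ᴹ : Fm → (ℕ → Carrier) → Carrier
  ⟦ φ ⟧ᴹ = ⟦_⟧ {𝓜 = 𝓜} φ

  ⟦inst⟧ : ∀ σ A γ → ⟦ inst σ A ⟧ᴹ γ ≡ ⟦ A ⟧ₚ (λ n → ⟦ σ n ⟧ᴹ γ)
  ⟦inst⟧ σ (pvar n) γ = ≡.refl
  ⟦inst⟧ σ p⊥       γ = ≡.refl
  ⟦inst⟧ σ (A p⇒ B) γ = ≡.cong₂ _⇨_ (⟦inst⟧ σ A γ) (⟦inst⟧ σ B γ)
  ⟦inst⟧ σ (A p∨ B) γ = ≡.cong₂ _∨_ (⟦inst⟧ σ A γ) (⟦inst⟧ σ B γ)
  ⟦inst⟧ σ (A p∧ B) γ = ≡.cong₂ _∧_ (⟦inst⟧ σ A γ) (⟦inst⟧ σ B γ)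

  ⟦[≔]⟧-cong : ∀ χ x {φ ψ} γ → ⟦ φ ⟧ᴹ γ ≈ ⟦ ψ ⟧ᴹ γ →
               ⟦ χ [ x ≔ φ ] ⟧ᴹ γ ≈ ⟦ χ [ x ≔ ψ ] ⟧ᴹ γ
  ⟦[≔]⟧-cong (var y) x γ e with y ≟ x
  ... | yes _ = e
  ... | no  _ = Eq.refl
  ⟦[≔]⟧-cong ⊥′        x γ e = Eq.refl
  ⟦[≔]⟧-cong (χ ⇒ χ′)  x γ e = ⇨-cong (⟦[≔]⟧-cong χ x γ e) (⟦[≔]⟧-cong χ′ x γ e)
  ⟦[≔]⟧-cong (χ ∨′ χ′) x γ e = ∨-cong (⟦[≔]⟧-cong χ x γ e) (⟦[≔]⟧-cong χ′ x γ e)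
  ⟦[≔]⟧-cong (χ ∧′ χ′) x γ e = ∧-cong (⟦[≔]⟧-cong χ x γ e) (⟦[≔]⟧-cong χ′ x γ e)
  ⟦[≔]⟧-cong (□ χ)     x γ e = f□-cong (⟦[≔]⟧-cong χ x γ e)

  Axiom-valid : ∀ {φ} → Axiom φ → ∀ γ → ⊤ ≤ ⟦ φ ⟧ᴹ γ
  Axiom-valid (ax-int {A} d σ) γ =
    ≡.subst (⊤ ≤_) (≡.sym (⟦inst⟧ σ A γ)) (IPC-valid d (λ n → ⟦ σ n ⟧ᴹ γ))
  Axiom-valid (ax-T φ)      γ = ⇨-intro (trans π₂ (cond1 _))
  Axiom-valid (ax-tr φ ψ χ) γ = ⇨-intro (⇨-intro (⇨-elim (trans π₁ (trans π₂ (cond2 _ _ _))) π₂))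
  Axiom-valid (ax-dis φ ψ)  γ = ⇨-intro (trans π₂ (cond3 _ _))

  ⊤≤⇒□-∈ : ∀ {a} → ⊤ ≤ a → f□ a ∈ TRUE
  ⊤≤⇒□-∈ p = proj₂ (cond4 _) (antisym (maximum _) p)

  □-⇨-∈⇒≤ : ∀ {a b} → f□ (a ⇨ b) ∈ TRUE → a ≤ b
  □-⇨-∈⇒≤ = ⇨≈⊤⇒≤ ∘ proj₁ (cond4 _)

  ≤⇒□-⇨-∈ : ∀ {a b} → a ≤ b → f□ (a ⇨ b) ∈ TRUE
  ≤⇒□-⇨-∈ = proj₂ (cond4 _) ∘ ≤⇒⇨≈⊤

  ≡′-∈⇒≈ : ∀ φ ψ γ → ⟦ φ ≡′ ψ ⟧ᴹ γ ∈ TRUE → ⟦ φ ⟧ᴹ γ ≈ ⟦ ψ ⟧ᴹ γ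
  ≡′-∈⇒≈ φ ψ γ h = antisym (□-⇨-∈⇒≤ (up-closed h π₁))
                           (□-⇨-∈⇒≤ (up-closed h π₂))

  ≈⇒≡′-∈ : ∀ φ ψ γ → ⟦ φ ⟧ᴹ γ ≈ ⟦ ψ ⟧ᴹ γ → ⟦ φ ≡′ ψ ⟧ᴹ γ ∈ TRUE
  ≈⇒≡′-∈ φ ψ γ e = ∧-closed (≤⇒□-⇨-∈ (reflexive e)) (≤⇒□-⇨-∈ (reflexive (Eq.sym e)))

  congr-∈ : ∀ φ ψ χ x γ → ⟦ (φ ≡′ ψ) ⇒ ((χ [ x ≔ φ ]) ≡′ (χ [ x ≔ ψ ])) ⟧ᴹ γ ∈ TRUE
  congr-∈ φ ψ χ x γ =
    ∈-⇨-intro (≈⇒≡′-∈ (χ [ x ≔ φ ]) (χ [ x ≔ ψ ]) γ ∘ ⟦[≔]⟧-cong χ x {φ} {ψ} γ ∘ ≡′-∈⇒≈ φ ψ γ)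

  ⊢L⇒∈TRUE : ∀ {p} {Φ : Pred Fm p} γ → (∀ ψ → ψ ∈ Φ → ⟦ ψ ⟧ᴹ γ ∈ TRUE) →
             ∀ {φ} → Φ ⊢L φ → ⟦ φ ⟧ᴹ γ ∈ TRUE
  ⊢L⇒∈TRUE γ Φ-true (hyp {φ} φ∈Φ)    = Φ-true φ φ∈Φ
  ⊢L⇒∈TRUE γ Φ-true (axiom a)        = ⊤≤⇒∈ (Axiom-valid a γ)
  ⊢L⇒∈TRUE γ Φ-true (tnd φ)          = ∈-excluded-middle (⟦ φ ⟧ᴹ γ)
  ⊢L⇒∈TRUE γ Φ-true (congr φ ψ χ x)  = congr-∈ φ ψ χ x γ
  ⊢L⇒∈TRUE γ Φ-true (MP d e)         = ∈-⇨-elim (⊢L⇒∈TRUE γ Φ-true d) (⊢L⇒∈TRUE γ Φ-true e)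
  ⊢L⇒∈TRUE γ Φ-true (AN a)           = ⊤≤⇒□-∈ (Axiom-valid a γ)

theorem3p8 : ∀ {p c ℓ₁ ℓ₂ t : Level} (Φ : Pred Fm p) (φ : Fm) →
    Φ ⊢L φ → Φ ⊩[ c , ℓ₁ , ℓ₂ , t ] φ
theorem3p8 Φ φ d 𝓜 γ Φ-true = ModelProperties.⊢L⇒∈TRUE 𝓜 γ Φ-true d
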